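{- Let $G=(V,E)$ be a graph, $u,v\in V$ distinct, let $\mathcal{H}=\{H_1,\dots,H_k\}$ be a $uv$-compatible family with $H_j\cap H_l=\{u,v\}$ for all $1\le j<l\le k$, and let $Y\subseteq V$ with $|Y|\ge4$ and $|Y\cap\{u,v\}|\le1$. Suppose that for some $1\le i\le k$ either $|Y\cap H_i|\ge2$, or $|Y\cap H_i|=1$ and $|H_i|\ge4$. Then there is a $uv$-compatible family $\mathcal{H}'$ with $\mathrm{cov}(\mathcal{H})\cup\mathrm{cov}(Y)\subseteq\mathrm{cov}(\mathcal{H}')$ and $\mathrm{val}(\mathcal{H}')\le\mathrm{val}(\mathcal{H})+\mathrm{val}(Y)$. Furthermore, if $G$ is $uv$-sparse and $\mathcal{H}$ and $Y$ are both tight, then $\mathcal{H}'$ and $Y\cap H_i$ are also tight.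
   Context: Graphs are finite and simple. $i(X)$ counts edges with both ends in $X\subseteq V$; for a family $\mathcal{S}$ of subsets, $i(\mathcal{S})$ counts edges with both ends in some member, $\mathrm{cov}(\mathcal{S})=\{(x,y):x,y\in V,\{x,y\}\subseteq S\text{ for some }S\in\mathcal{S}\}$, $\mathrm{cov}(Y)=\mathrm{cov}(\{Y\})$. For nonempty $H\subseteq V$, $\mathrm{val}(H)=2|H|-t_H$ with $t_H=4$ if $H=\{u,v\}$, $t_H=3$ if $H\ne\{u,v\}$ and $|H|\in\{2,3\}$, $t_H=2$ otherwise. $\mathcal{H}$ is $uv$-compatible if each member contains $u,v$ and has size $\ge3$; $\mathrm{val}(\mathcal{H})=\sum_j\mathrm{val}(H_j)-2(k-1)$. $G$ is $uv$-sparse if $i(H)\le\mathrm{val}(H)$ for all $H\subseteq V$ with $|H|\ge2$ and $i(\mathcal{H})\le\mathrm{val}(\mathcal{H})$ for all $uv$-compatible $\mathcal{H}$. Sets $H$ ($|H|\ge2$) and families are tight when $i=\mathrm{val}$. -}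

module Defs where

open import Data.Bool using (Bool; true; false; if_then_else_; _∧_)
import Data.Bool as B
open import Data.Nat using (ℕ; zero; suc; _≤_; _≡ᵇ_)
import Data.Nat
open import Data.Integer using (ℤ; +_; _-_)
import Data.Integer as ℤ
open import Data.Fin using (Fin; toℕ)
import Data.Fin as F
open import Data.Fin.Subset using (Subset; _∈_; _∩_; _∪_; ⁅_⁆; ∣_∣)
open import Data.Fin.Subset.Properties using (_∈?_)
import Data.List
open import Data.List using (List; map; length; allFin)
open import Data.Nat.ListAction using (sum)
open import Data.List.Relation.Unary.All using (All)
open import Data.List.Relation.Unary.Any using (Any; any?)
open import Data.List.Relation.Unary.Unique.Propositional using (Unique)
open import Data.Product using (_×_; _,_)
open import Data.Vec.Properties using (≡-dec)
open import Relation.Nullary using (Dec; does)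
open import Relation.Nullary.Decidable using (_×-dec_)
open import Relation.Binary.PropositionalEquality using (_≡_)

record Graph (n : ℕ) : Set where
  field
    adj    : Fin n → Fin n → Bool
    sym    : ∀ x y → adj x y ≡ adj y x
    irrefl : ∀ x → adj x x ≡ false
open Graph public

pair : ∀ {n} → Fin n → Fin n → Subset n
pair u v = ⁅ u ⁆ ∪ ⁅ v ⁆

_≟ˢ_ : ∀ {n} (X Y : Subset n) → Dec (X ≡ Y)
_≟ˢ_ = ≡-dec B._≟_

countEdges : ∀ {n} → Graph n → (Fin n → Fin n → Bool) → ℕ
countEdges {n} G P =
  sum (map (λ x → sum (map (λ y →
        if does (x F.<? y) ∧ adj G x y ∧ P x y then 1 else 0)
      (allFin n))) (allFin n))

Cov : ∀ {n} → List (Subset n) → Fin n → Fin n → Set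
Cov 𝓗 x y = Any (λ S → x ∈ S × y ∈ S) 𝓗

iSet : ∀ {n} → Graph n → Subset n → ℕ
iSet G X = countEdges G (λ x y → does (x ∈? X) ∧ does (y ∈? X))

iFam : ∀ {n} → Graph n → List (Subset n) → ℕ
iFam G 𝓗 = countEdges G (λ x y → does (any? (λ S → (x ∈? S) ×-dec (y ∈? S)) 𝓗))

tval : ∀ {n} → Fin n → Fin n → Subset n → ℕ
tval u v H =
  if does (H ≟ˢ pair u v) then 4
  else (if (∣ H ∣ ≡ᵇ 2) B.∨ (∣ H ∣ ≡ᵇ 3) then 3 else 2)

valSet : ∀ {n} → Fin n → Fin n → Subset n → ℤ
valSet u v H = + (2 Data.Nat.* ∣ H ∣) - + tval u v H

valFam : ∀ {n} → Fin n → Fin n → List (Subset n) → ℤ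
valFam u v 𝓗 = Data.List.foldr ℤ._+_ (+ 0) (map (valSet u v) 𝓗) - (+ 2 ℤ.* (+ length 𝓗 - + 1))

-- uv-compatible family: each member contains u, v and has size ≥ 3
-- (a family of sets: members listed without repetition).
UVCompatible : ∀ {n} → Fin n → Fin n → List (Subset n) → Set
UVCompatible u v 𝓗 =
  All (λ H → u ∈ H × v ∈ H × 3 ≤ ∣ H ∣) 𝓗 × Unique 𝓗

UVSparse : ∀ {n} → Graph n → Fin n → Fin n → Set
UVSparse G u v =
  (∀ H → 2 ≤ ∣ H ∣ → + iSet G H ℤ.≤ valSet u v H) ×
  (∀ 𝓗 → UVCompatible u v 𝓗 → + iFam G 𝓗 ℤ.≤ valFam u v 𝓗)

TightSet : ∀ {n} → Graph n → Fin n → Fin n → Subset n → Set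
TightSet G u v H = + iSet G H ≡ valSet u v H

TightFam : ∀ {n} → Graph n → Fin n → Fin n → List (Subset n) → Set
TightFam G u v 𝓗 = + iFam G 𝓗 ≡ valFam u v 𝓗

-- Y is merged with the members it meets substantially (the members Y absorbs); the others are
-- kept.  As |Y ∩ {u,v}| ≤ 1, some w ∈ {u,v} lies outside Y and in every member, so inclusion–
-- exclusion gives |hub| ≤ |Y| + 1 + Σ (|H| - |Y ∩ H| - 1) over the absorbed H, where
-- hub = {w} ∪ Y ∪ ⋃ absorbed.  This turns into
--   val(hub ∷ kept) + Σ s(H) ≤ val(𝓗) + val(Y),   s(H) = 2|Y ∩ H| - t_H ≥ val(Y ∩ H) ≥ 0.
-- For tightness, every edge counted both in i(𝓗) and in i(Y) lies in Y ∩ H for an absorbed H, so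
-- i(𝓗) + i(Y) ≤ i(hub ∷ kept) + Σ i(Y ∩ H).  Sparsity bounds the right-hand terms by
-- val(hub ∷ kept) and the s(H), and the resulting cycle of inequalities through val(𝓗) + val(Y)
-- forces equality everywhere, in particular i(Y ∩ Hᵢ) = s(Hᵢ) ≥ val(Y ∩ Hᵢ) ≥ i(Y ∩ Hᵢ).
module Submission where

import Algebra.Properties.CommutativeSemigroup as CommutativeSemigroupProperties
open import Data.Bool using (Bool; true; false; T; if_then_else_; _∧_; _∨_)
open import Data.Bool.Properties using (T-∧; T-∨)
open import Data.Empty using (⊥; ⊥-elim)
open import Data.Fin as F using (Fin)
import Data.Fin.Properties as FP
open import Data.Fin.Subset using (Subset; _∈_; _∉_; _∩_; _∪_; ⁅_⁆; ∣_∣; _⊆_)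
open import Data.Fin.Subset.Properties using (_∈?_)
import Data.Fin.Subset.Properties as SP
open import Data.Integer as ℤ using (ℤ; +_; _+_; _-_)
import Data.Integer.Properties as ℤP
open import Data.Integer.Tactic.RingSolver using (solve-∀)
open import Data.List using (List; []; _∷_; map; allFin; foldr; filter; length; lookup)
open import Data.List.Membership.Propositional using (find; lose) renaming (_∈_ to _∈ₗ_)
open import Data.List.Membership.Propositional.Properties using (∈-filter⁺; ∈-filter⁻; ∈-lookup; ∈-map⁺)
open import Data.List.Properties using (map-cong; map-∘)
open import Data.List.Relation.Unary.All as All using (All; []; _∷_)
import Data.List.Relation.Unary.All.Properties as AllP
open import Data.List.Relation.Unary.AllPairs using (_∷_)
open import Data.List.Relation.Unary.Any using (here; there; any?)
import Data.List.Relation.Unary.Unique.Propositional.Properties as UniqueP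
open import Data.Nat as ℕ using (ℕ; suc; _≤_; z≤n; s≤s; _≡ᵇ_)
import Data.Nat.Properties as ℕP
open import Data.Nat.ListAction using (sum)
open import Data.Product using (Σ; _×_; _,_; proj₁; proj₂)
open import Data.Sum using (_⊎_; inj₁; inj₂)
open import Data.Unit using (tt)
open import Data.Vec using ([]; _∷_)
open import Function using (_∘_)
open import Function.Bundles using (Equivalence)
open import Relation.Binary.PropositionalEquality
open import Relation.Nullary using (Dec; yes; no; does; ¬?)
open import Relation.Nullary.Decidable using (_×-dec_; _⊎-dec_)
open import Relation.Unary using (Decidable)
open import Defs hiding (sym)

module ℕCS = CommutativeSemigroupProperties ℕP.+-commutativeSemigroup
module ℤCS = CommutativeSemigroupProperties ℤP.+-commutativeSemigroup

-- Decidable.toWitness is phrased with isYes, which does not reduce to does on a neutral decision.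
does⇒ : ∀ {A : Set} (a? : Dec A) → T (does a?) → A
does⇒ (yes a) _ = a

⇒does : ∀ {A : Set} (a? : Dec A) → A → T (does a?)
⇒does (yes _) _ = tt
⇒does (no ¬a) a = ¬a a

module _ {A : Set} where

  sum-map-mono : ∀ {f g : A → ℕ} {xs} → All (λ x → f x ≤ g x) xs → sum (map f xs) ≤ sum (map g xs)
  sum-map-mono []            = z≤n
  sum-map-mono (fx≤gx ∷ f≤g) = ℕP.+-mono-≤ fx≤gx (sum-map-mono f≤g)

  sum-map-+ : ∀ (f g : A → ℕ) xs → sum (map (λ x → f x ℕ.+ g x) xs) ≡ sum (map f xs) ℕ.+ sum (map g xs)
  sum-map-+ f g []       = refl
  sum-map-+ f g (x ∷ xs) = trans (cong (f x ℕ.+ g x ℕ.+_) (sum-map-+ f g xs))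
                                 (ℕCS.interchange (f x) (g x) (sum (map f xs)) (sum (map g xs)))

  sum-map-zero : ∀ (xs : List A) → sum (map (λ _ → 0) xs) ≡ 0
  sum-map-zero []       = refl
  sum-map-zero (x ∷ xs) = sum-map-zero xs

module _ {n : ℕ} where

  sumPairs : (Fin n → Fin n → ℕ) → ℕ
  sumPairs f = sum (map (λ x → sum (map (f x) (allFin n))) (allFin n))

  sumPairs-mono : ∀ {f g} → (∀ x y → f x y ≤ g x y) → sumPairs f ≤ sumPairs g
  sumPairs-mono {f} {g} f≤g = sum-map-mono {xs = allFin n} (All.tabulate λ {x} _ →
    sum-map-mono {f = f x} {g = g x} {xs = allFin n} (All.tabulate λ {y} _ → f≤g x y))

  sumPairs-cong : ∀ {f g} → (∀ x y → f x y ≡ g x y) → sumPairs f ≡ sumPairs g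
  sumPairs-cong f≡g = cong sum (map-cong (λ x → cong sum (map-cong (f≡g x) (allFin n))) (allFin n))

  sumPairs-+ : ∀ f g → sumPairs (λ x y → f x y ℕ.+ g x y) ≡ sumPairs f ℕ.+ sumPairs g
  sumPairs-+ f g = trans (cong sum (map-cong (λ x → sum-map-+ (f x) (g x) (allFin n)) (allFin n)))
                         (sum-map-+ _ _ (allFin n))

  sumPairs-zero : sumPairs (λ _ _ → 0) ≡ 0
  sumPairs-zero = trans (cong sum (map-cong (λ _ → sum-map-zero (allFin n)) (allFin n)))
                        (sum-map-zero (allFin n))

⟦_⟧ : Bool → ℕ
⟦ b ⟧ = if b then 1 else 0

⟦⟧-mono : ∀ {a b} → (T a → T b) → ⟦ a ⟧ ≤ ⟦ b ⟧
⟦⟧-mono {false}         _   = z≤n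
⟦⟧-mono {true} {true}   _   = ℕP.≤-refl
⟦⟧-mono {true} {false} a⇒b = ⊥-elim (a⇒b tt)

⟦∨⟧+⟦∧⟧ : ∀ a b → ⟦ a ∨ b ⟧ ℕ.+ ⟦ a ∧ b ⟧ ≡ ⟦ a ⟧ ℕ.+ ⟦ b ⟧
⟦∨⟧+⟦∧⟧ false b     = ℕP.+-comm ⟦ b ⟧ 0
⟦∨⟧+⟦∧⟧ true  false = refl
⟦∨⟧+⟦∧⟧ true  true  = refl

guarded-mono : ∀ d a {p q} → (T d → T a → T p → T q) → T (d ∧ a ∧ p) → T (d ∧ a ∧ q)
guarded-mono true  true  h = h tt tt
guarded-mono true  false h = λ ()
guarded-mono false a     h = λ ()

guarded-∨-∧ : ∀ d a p q → ⟦ d ∧ a ∧ (p ∨ q) ⟧ ℕ.+ ⟦ d ∧ a ∧ p ∧ q ⟧ ≡ ⟦ d ∧ a ∧ p ⟧ ℕ.+ ⟦ d ∧ a ∧ q ⟧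
guarded-∨-∧ true  true  p q = ⟦∨⟧+⟦∧⟧ p q
guarded-∨-∧ true  false p q = refl
guarded-∨-∧ false a     p q = refl

guarded-none : ∀ d a {p} → (T d → T a → T p → ⊥) → ⟦ d ∧ a ∧ p ⟧ ≤ 0
guarded-none true  true  {true}  h = ⊥-elim (h tt tt tt)
guarded-none true  true  {false} h = z≤n
guarded-none true  false         h = z≤n
guarded-none false a             h = z≤n

module _ {n : ℕ} (G : Graph n) where

  edgeIndicator : (Fin n → Fin n → Bool) → Fin n → Fin n → ℕ
  edgeIndicator P x y = ⟦ does (x F.<? y) ∧ adj G x y ∧ P x y ⟧

  countEdges-mono : ∀ {P Q} → (∀ x y → x F.< y → T (adj G x y) → T (P x y) → T (Q x y)) →
                    countEdges G P ≤ countEdges G Q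
  countEdges-mono {P} {Q} P⇒Q = sumPairs-mono {f = edgeIndicator P} {g = edgeIndicator Q} λ x y →
    ⟦⟧-mono (guarded-mono (does (x F.<? y)) (adj G x y) λ x<y → P⇒Q x y (does⇒ (x F.<? y) x<y))

  countEdges-∨-∧ : ∀ P Q → countEdges G (λ x y → P x y ∨ Q x y) ℕ.+ countEdges G (λ x y → P x y ∧ Q x y)
                           ≡ countEdges G P ℕ.+ countEdges G Q
  countEdges-∨-∧ P Q = begin
    countEdges G P∨Q ℕ.+ countEdges G P∧Q
      ≡⟨ sumPairs-+ (edgeIndicator P∨Q) (edgeIndicator P∧Q) ⟨
    sumPairs (λ x y → edgeIndicator P∨Q x y ℕ.+ edgeIndicator P∧Q x y)
      ≡⟨ sumPairs-cong (λ x y → guarded-∨-∧ (does (x F.<? y)) (adj G x y) (P x y) (Q x y)) ⟩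
    sumPairs (λ x y → edgeIndicator P x y ℕ.+ edgeIndicator Q x y)
      ≡⟨ sumPairs-+ (edgeIndicator P) (edgeIndicator Q) ⟩
    countEdges G P ℕ.+ countEdges G Q ∎
    where
    open ≡-Reasoning
    P∨Q P∧Q : Fin n → Fin n → Bool
    P∨Q x y = P x y ∨ Q x y
    P∧Q x y = P x y ∧ Q x y

  countEdges-none : ∀ P → (∀ x y → x F.< y → T (adj G x y) → T (P x y) → ⊥) → countEdges G P ≡ 0
  countEdges-none P none = ℕP.n≤0⇒n≡0 (ℕP.≤-trans
    (sumPairs-mono {f = edgeIndicator P} {g = λ _ _ → 0} λ x y →
      guarded-none (does (x F.<? y)) (adj G x y) λ x<y → none x y (does⇒ (x F.<? y) x<y))
    (ℕP.≤-reflexive (sumPairs-zero {n})))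

  iFam≤sum-iSet : ∀ 𝓛 → iFam G 𝓛 ≤ sum (map (iSet G) 𝓛)
  iFam≤sum-iSet []      = ℕP.≤-reflexive (countEdges-none _ λ _ _ _ _ ())
  iFam≤sum-iSet (S ∷ 𝓛) = begin
    iFam G (S ∷ 𝓛)                                                 ≤⟨ ℕP.m≤m+n _ _ ⟩
    iFam G (S ∷ 𝓛) ℕ.+ countEdges G (λ x y → inS x y ∧ in𝓛 x y)   ≡⟨ countEdges-∨-∧ inS in𝓛 ⟩
    iSet G S ℕ.+ iFam G 𝓛                                          ≤⟨ ℕP.+-monoʳ-≤ (iSet G S) (iFam≤sum-iSet 𝓛) ⟩
    iSet G S ℕ.+ sum (map (iSet G) 𝓛)                              ∎
    where
    open ℕP.≤-Reasoning
    inS in𝓛 : Fin n → Fin n → Bool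
    inS x y = does (x ∈? S) ∧ does (y ∈? S)
    in𝓛 x y = does (any? (λ S → (x ∈? S) ×-dec (y ∈? S)) 𝓛)

∣p∪q∣+∣p∩q∣≡∣p∣+∣q∣ : ∀ {n} (p q : Subset n) → ∣ p ∪ q ∣ ℕ.+ ∣ p ∩ q ∣ ≡ ∣ p ∣ ℕ.+ ∣ q ∣
∣p∪q∣+∣p∩q∣≡∣p∣+∣q∣ []          []          = refl
∣p∪q∣+∣p∩q∣≡∣p∣+∣q∣ (true ∷ p)  (true ∷ q)  = cong suc (trans (ℕP.+-suc _ _)
                                                (trans (cong suc (∣p∪q∣+∣p∩q∣≡∣p∣+∣q∣ p q)) (sym (ℕP.+-suc _ _))))
∣p∪q∣+∣p∩q∣≡∣p∣+∣q∣ (true ∷ p)  (false ∷ q) = cong suc (∣p∪q∣+∣p∩q∣≡∣p∣+∣q∣ p q)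
∣p∪q∣+∣p∩q∣≡∣p∣+∣q∣ (false ∷ p) (true ∷ q)  = trans (cong suc (∣p∪q∣+∣p∩q∣≡∣p∣+∣q∣ p q)) (sym (ℕP.+-suc _ _))
∣p∪q∣+∣p∩q∣≡∣p∣+∣q∣ (false ∷ p) (false ∷ q) = ∣p∪q∣+∣p∩q∣≡∣p∣+∣q∣ p q

module _ {n : ℕ} where

  ∣p∪q∣≤∣p∣+∣q∣ : ∀ (p q : Subset n) → ∣ p ∪ q ∣ ≤ ∣ p ∣ ℕ.+ ∣ q ∣
  ∣p∪q∣≤∣p∣+∣q∣ p q = ℕP.m+n≤o⇒m≤o _ (ℕP.≤-reflexive (∣p∪q∣+∣p∩q∣≡∣p∣+∣q∣ p q))

  x≢y⇒2≤∣p∣ : ∀ {p : Subset n} {x y} → x ≢ y → x ∈ p → y ∈ p → 2 ≤ ∣ p ∣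
  x≢y⇒2≤∣p∣ {p} {x} {y} x≢y x∈p y∈p = subst (λ k → suc k ≤ ∣ p ∣) (SP.∣⁅x⁆∣≡1 x)
    (SP.p⊂q⇒∣p∣<∣q∣ ( (λ z∈⁅x⁆ → subst (_∈ p) (sym (SP.x∈⁅y⁆⇒x≡y x z∈⁅x⁆)) x∈p)
                     , y , y∈p , λ y∈⁅x⁆ → x≢y (sym (SP.x∈⁅y⁆⇒x≡y x y∈⁅x⁆))))

  ∣pair∣≤2 : ∀ (u v : Fin n) → ∣ pair u v ∣ ≤ 2
  ∣pair∣≤2 u v = subst (∣ pair u v ∣ ≤_) (cong₂ ℕ._+_ (SP.∣⁅x⁆∣≡1 u) (SP.∣⁅x⁆∣≡1 v))
                       (∣p∪q∣≤∣p∣+∣q∣ ⁅ u ⁆ ⁅ v ⁆)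

  _∪⋃_ : Subset n → List (Subset n) → Subset n
  Z ∪⋃ 𝓛 = foldr _∪_ Z 𝓛

  p⊆p∪⋃ : ∀ Z 𝓛 → Z ⊆ Z ∪⋃ 𝓛
  p⊆p∪⋃ Z []      x∈Z = x∈Z
  p⊆p∪⋃ Z (B ∷ 𝓛) x∈Z = SP.q⊆p∪q B _ (p⊆p∪⋃ Z 𝓛 x∈Z)

  ∈⇒⊆∪⋃ : ∀ Z {B 𝓛} → B ∈ₗ 𝓛 → B ⊆ Z ∪⋃ 𝓛
  ∈⇒⊆∪⋃ Z (here refl)          = SP.p⊆p∪q _
  ∈⇒⊆∪⋃ Z {𝓛 = C ∷ _} (there B∈𝓛) = SP.q⊆p∪q C _ ∘ ∈⇒⊆∪⋃ Z B∈𝓛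

  ∣∪⋃∣-bound : ∀ Z 𝓛 → ∣ Z ∪⋃ 𝓛 ∣ ℕ.+ sum (map (λ B → ∣ B ∩ Z ∣) 𝓛) ≤ ∣ Z ∣ ℕ.+ sum (map ∣_∣ 𝓛)
  ∣∪⋃∣-bound Z []      = ℕP.≤-refl
  ∣∪⋃∣-bound Z (B ∷ 𝓛) = begin
    ∣ B ∪ U ∣ ℕ.+ (∣ B ∩ Z ∣ ℕ.+ Σ∩)   ≤⟨ ℕP.+-monoʳ-≤ ∣ B ∪ U ∣ (ℕP.+-monoˡ-≤ Σ∩ (SP.p⊆q⇒∣p∣≤∣q∣ B∩Z⊆B∩U)) ⟩
    ∣ B ∪ U ∣ ℕ.+ (∣ B ∩ U ∣ ℕ.+ Σ∩)   ≡⟨ ℕP.+-assoc ∣ B ∪ U ∣ _ _ ⟨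
    (∣ B ∪ U ∣ ℕ.+ ∣ B ∩ U ∣) ℕ.+ Σ∩   ≡⟨ cong (ℕ._+ Σ∩) (∣p∪q∣+∣p∩q∣≡∣p∣+∣q∣ B U) ⟩
    (∣ B ∣ ℕ.+ ∣ U ∣) ℕ.+ Σ∩           ≡⟨ ℕP.+-assoc ∣ B ∣ _ _ ⟩
    ∣ B ∣ ℕ.+ (∣ U ∣ ℕ.+ Σ∩)           ≤⟨ ℕP.+-monoʳ-≤ ∣ B ∣ (∣∪⋃∣-bound Z 𝓛) ⟩
    ∣ B ∣ ℕ.+ (∣ Z ∣ ℕ.+ Σ∣∣)          ≡⟨ ℕCS.x∙yz≈y∙xz ∣ B ∣ ∣ Z ∣ Σ∣∣ ⟩
    ∣ Z ∣ ℕ.+ (∣ B ∣ ℕ.+ Σ∣∣)          ∎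
    where
    open ℕP.≤-Reasoning
    U = Z ∪⋃ 𝓛
    Σ∩ = sum (map (λ B → ∣ B ∩ Z ∣) 𝓛)
    Σ∣∣ = sum (map ∣_∣ 𝓛)
    B∩Z⊆B∩U : B ∩ Z ⊆ B ∩ U
    B∩Z⊆B∩U x∈B∩Z = let x∈B , x∈Z = SP.x∈p∩q⁻ B Z x∈B∩Z in SP.x∈p∩q⁺ (x∈B , p⊆p∪⋃ Z 𝓛 x∈Z)

+-cancelʳ-≤ : ∀ {i j} k → i + k ℤ.≤ j + k → i ℤ.≤ j
+-cancelʳ-≤ {i} {j} k i+k≤j+k = begin
  i           ≡⟨ i+k-k≡i i k ⟨
  i + k - k   ≤⟨ ℤP.+-monoˡ-≤ (ℤ.- k) i+k≤j+k ⟩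
  j + k - k   ≡⟨ i+k-k≡i j k ⟩
  j           ∎
  where
  open ℤP.≤-Reasoning
  i+k-k≡i : ∀ i k → i + k - k ≡ i
  i+k-k≡i = solve-∀

+-squeeze : ∀ {x X y Y} → x ℤ.≤ X → y ℤ.≤ Y → X + Y ℤ.≤ x + y → x ≡ X × y ≡ Y
+-squeeze {x} {X} {y} {Y} x≤X y≤Y X+Y≤x+y =
  ℤP.≤-antisym x≤X (+-cancelʳ-≤ Y (ℤP.≤-trans X+Y≤x+y (ℤP.+-monoʳ-≤ x y≤Y))) ,
  ℤP.≤-antisym y≤Y (+-cancelʳ-≤ X (subst₂ ℤ._≤_ (ℤP.+-comm X Y) (ℤP.+-comm X y)
                                     (ℤP.≤-trans X+Y≤x+y (ℤP.+-monoˡ-≤ y x≤X))))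

module _ {A : Set} where

  ∑ : (A → ℤ) → List A → ℤ
  ∑ f xs = foldr _+_ (+ 0) (map f xs)

  ∑-pos : ∀ (f : A → ℕ) xs → ∑ (λ x → + f x) xs ≡ + sum (map f xs)
  ∑-pos f []       = refl
  ∑-pos f (x ∷ xs) = trans (cong (_+_ (+ f x)) (∑-pos f xs)) (sym (ℤP.pos-+ (f x) _))

  ∑-cong : ∀ {f g : A → ℤ} → (∀ x → f x ≡ g x) → ∀ xs → ∑ f xs ≡ ∑ g xs
  ∑-cong f≡g xs = cong (foldr _+_ (+ 0)) (map-cong f≡g xs)

  ∑-+ : ∀ (f g : A → ℤ) xs → ∑ (λ x → f x + g x) xs ≡ ∑ f xs + ∑ g xs
  ∑-+ f g []       = refl
  ∑-+ f g (x ∷ xs) = trans (cong (_+_ (f x + g x)) (∑-+ f g xs)) (ℤCS.interchange (f x) (g x) _ _)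

  ∑-*ˡ : ∀ k (f : A → ℤ) xs → ∑ (λ x → k ℤ.* f x) xs ≡ k ℤ.* ∑ f xs
  ∑-*ˡ k f []       = sym (ℤP.*-zeroʳ k)
  ∑-*ˡ k f (x ∷ xs) = trans (cong (_+_ (k ℤ.* f x)) (∑-*ˡ k f xs)) (sym (ℤP.*-distribˡ-+ k (f x) _))

  ∑-+-*ˡ : ∀ (f : A → ℤ) k g xs → ∑ (λ x → f x + k ℤ.* g x) xs ≡ ∑ f xs + k ℤ.* ∑ g xs
  ∑-+-*ˡ f k g xs = trans (∑-+ f (λ x → k ℤ.* g x) xs) (cong (_+_ (∑ f xs)) (∑-*ˡ k g xs))

  ∑-nonneg : ∀ {f : A → ℤ} {xs} → All (λ x → + 0 ℤ.≤ f x) xs → + 0 ℤ.≤ ∑ f xs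
  ∑-nonneg []           = ℤP.≤-refl
  ∑-nonneg (0≤fx ∷ 0≤f) = ℤP.+-mono-≤ 0≤fx (∑-nonneg 0≤f)

  ∑-mono-≤ : ∀ {f g : A → ℤ} {xs} → All (λ x → f x ℤ.≤ g x) xs → ∑ f xs ℤ.≤ ∑ g xs
  ∑-mono-≤ []            = ℤP.≤-refl
  ∑-mono-≤ (fx≤gx ∷ f≤g) = ℤP.+-mono-≤ fx≤gx (∑-mono-≤ f≤g)

  ∑-squeeze : ∀ {f g : A → ℤ} {xs} → All (λ x → f x ℤ.≤ g x) xs → ∑ g xs ℤ.≤ ∑ f xs →
              ∀ {x} → x ∈ₗ xs → f x ≡ g x
  ∑-squeeze (fx≤gx ∷ f≤g) ∑g≤∑f x∈xs with +-squeeze fx≤gx (∑-mono-≤ f≤g) ∑g≤∑f | x∈xs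
  ... | fx≡gx , _     | here refl  = fx≡gx
  ... | _     , ∑f≡∑g | there x∈xs′ = ∑-squeeze f≤g (ℤP.≤-reflexive (sym ∑f≡∑g)) x∈xs′

  ∑-partition : ∀ {P : A → Set} (P? : Decidable P) f xs →
                ∑ f xs ≡ ∑ f (filter P? xs) + ∑ f (filter (¬? ∘ P?) xs)
  ∑-partition P? f []       = refl
  ∑-partition P? f (x ∷ xs) with P? x
  ... | yes _ = trans (cong (_+_ (f x)) (∑-partition P? f xs)) (sym (ℤP.+-assoc (f x) _ _))
  ... | no  _ = trans (cong (_+_ (f x)) (∑-partition P? f xs)) (ℤCS.x∙yz≈y∙xz (f x) (∑ f (filter P? xs)) _)

tvalOfSize : ℕ → ℕ
tvalOfSize k = if (k ≡ᵇ 2) ∨ (k ≡ᵇ 3) then 3 else 2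

2≤tvalOfSize : ∀ k → 2 ≤ tvalOfSize k
2≤tvalOfSize 0                         = ℕP.≤-refl
2≤tvalOfSize 1                         = ℕP.≤-refl
2≤tvalOfSize 2                         = ℕP.n≤1+n 2
2≤tvalOfSize 3                         = ℕP.n≤1+n 2
2≤tvalOfSize (suc (suc (suc (suc k)))) = ℕP.≤-refl

tvalOfSize-≥4 : ∀ {k} → 4 ≤ k → tvalOfSize k ≡ 2
tvalOfSize-≥4 (s≤s (s≤s (s≤s (s≤s _)))) = refl

tvalOfSize-antitone : ∀ {j k} → 2 ≤ j → j ≤ k → tvalOfSize k ≤ tvalOfSize j
tvalOfSize-antitone {j} {suc (suc (suc (suc _)))} _ _  = 2≤tvalOfSize j
tvalOfSize-antitone {2} {2} _ _                        = ℕP.≤-refl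
tvalOfSize-antitone {2} {3} _ _                        = ℕP.≤-refl
tvalOfSize-antitone {3} {3} _ _                        = ℕP.≤-refl
tvalOfSize-antitone {3} {2} _ (s≤s (s≤s ()))
tvalOfSize-antitone {suc (suc (suc (suc _)))} {2} _ (s≤s (s≤s ()))
tvalOfSize-antitone {suc (suc (suc (suc _)))} {3} _ (s≤s (s≤s (s≤s ())))
tvalOfSize-antitone {suc (suc _)} {0} _ ()
tvalOfSize-antitone {suc (suc _)} {1} _ (s≤s ())
tvalOfSize-antitone {1} (s≤s ()) _

tvalOfSize≤2* : ∀ {k} → 1 ≤ k → tvalOfSize k ≤ 2 ℕ.* k
tvalOfSize≤2* {1}                         _ = ℕP.≤-refl
tvalOfSize≤2* {2}                         _ = ℕP.n≤1+n 3
tvalOfSize≤2* {3}                         _ = ℕP.m≤m+n 3 3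
tvalOfSize≤2* {suc (suc (suc (suc k)))}   _ = s≤s (s≤s z≤n)

∣p∣≡1⇒iSet≡0 : ∀ {n} (G : Graph n) {X : Subset n} → ∣ X ∣ ≡ 1 → iSet G X ≡ 0
∣p∣≡1⇒iSet≡0 G {X} ∣X∣≡1 = countEdges-none G _ λ x y x<y _ x,y∈X →
  let x∈X , y∈X = Equivalence.to T-∧ x,y∈X in
  ℕP.<-irrefl refl (subst (2 ≤_) ∣X∣≡1 (x≢y⇒2≤∣p∣ (FP.<⇒≢ x<y) (does⇒ (x ∈? X) x∈X) (does⇒ (y ∈? X) y∈X)))

module _ {n : ℕ} (u v : Fin n) where

  tval-≢pair : ∀ H → H ≢ pair u v → tval u v H ≡ tvalOfSize ∣ H ∣
  tval-≢pair H H≢uv with H ≟ˢ pair u v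
  ... | yes H≡uv = ⊥-elim (H≢uv H≡uv)
  ... | no  _    = refl

  3≤∣p∣⇒p≢pair : ∀ {H} → 3 ≤ ∣ H ∣ → H ≢ pair u v
  3≤∣p∣⇒p≢pair 3≤∣H∣ refl with ℕP.≤-trans 3≤∣H∣ (∣pair∣≤2 u v)
  ... | s≤s (s≤s ())

  valSet-≥4 : ∀ H → 4 ≤ ∣ H ∣ → valSet u v H ≡ + 2 ℤ.* + ∣ H ∣ - + 2
  valSet-≥4 H 4≤∣H∣ = cong₂ (λ p t → p - + t) (ℤP.pos-* 2 ∣ H ∣)
    (trans (tval-≢pair H (3≤∣p∣⇒p≢pair (ℕP.≤-trans (ℕP.n≤1+n 3) 4≤∣H∣))) (tvalOfSize-≥4 4≤∣H∣))

  valSet-nonneg : ∀ X → 1 ≤ ∣ X ∣ → X ≢ pair u v → + 0 ℤ.≤ valSet u v X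
  valSet-nonneg X 1≤∣X∣ X≢uv = subst (λ t → + 0 ℤ.≤ + (2 ℕ.* ∣ X ∣) - + t) (sym (tval-≢pair X X≢uv))
    (ℤP.i≤j⇒0≤j-i (ℤ.+≤+ (tvalOfSize≤2* 1≤∣X∣)))

  famTerm : Subset n → ℤ
  famTerm B = valSet u v B - + 2

  valFam-∷ : ∀ B 𝓛 → valFam u v (B ∷ 𝓛) ≡ famTerm B + valFam u v 𝓛
  valFam-∷ B 𝓛 = begin
    (valSet u v B + s) - + 2 ℤ.* (+ suc k - + 1)
      ≡⟨ cong (λ z → (valSet u v B + s) - + 2 ℤ.* (z - + 1)) (ℤP.pos-+ 1 k) ⟩
    (valSet u v B + s) - + 2 ℤ.* ((+ 1 + + k) - + 1)
      ≡⟨ regroup (valSet u v B) s (+ k) ⟩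
    (valSet u v B - + 2) + (s - + 2 ℤ.* (+ k - + 1)) ∎
    where
    open ≡-Reasoning
    s = ∑ (valSet u v) 𝓛
    k = length 𝓛
    regroup : ∀ x s k → (x + s) - + 2 ℤ.* ((+ 1 + k) - + 1) ≡ (x - + 2) + (s - + 2 ℤ.* (k - + 1))
    regroup = solve-∀

  valFam-∑ : ∀ 𝓛 → valFam u v 𝓛 ≡ + 2 + ∑ famTerm 𝓛
  valFam-∑ []      = refl
  valFam-∑ (B ∷ 𝓛) = trans (valFam-∷ B 𝓛) (trans (cong (_+_ (famTerm B)) (valFam-∑ 𝓛))
                                                 (ℤCS.x∙yz≈y∙xz (famTerm B) (+ 2) _))

module _ {n : ℕ} (Y : Subset n) where

  Absorbs : Subset n → Set
  Absorbs B = 2 ≤ ∣ Y ∩ B ∣ ⊎ (∣ Y ∩ B ∣ ≡ 1 × 4 ≤ ∣ B ∣)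

  absorbs? : Decidable Absorbs
  absorbs? B = (2 ℕ.≤? ∣ Y ∩ B ∣) ⊎-dec ((∣ Y ∩ B ∣ ℕ.≟ 1) ×-dec (4 ℕ.≤? ∣ B ∣))

  absorbs⇒1≤∣∩∣ : ∀ {B} → Absorbs B → 1 ≤ ∣ Y ∩ B ∣
  absorbs⇒1≤∣∩∣ (inj₁ 2≤∣Y∩B∣)       = ℕP.≤-trans (ℕP.n≤1+n 1) 2≤∣Y∩B∣
  absorbs⇒1≤∣∩∣ (inj₂ (∣Y∩B∣≡1 , _)) = ℕP.≤-reflexive (sym ∣Y∩B∣≡1)

module _ {n : ℕ} (u v : Fin n) (Y : Subset n) where

  surplus : Subset n → ℤ
  surplus B = + (2 ℕ.* ∣ Y ∩ B ∣) - + tval u v B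

  famTerm+2*∣∩∣≡surplus+2*∣∣ : ∀ B → famTerm u v B + + 2 ℤ.* + suc ∣ Y ∩ B ∣ ≡ surplus B + + 2 ℤ.* + ∣ B ∣
  famTerm+2*∣∩∣≡surplus+2*∣∣ B = begin
    ((+ (2 ℕ.* b) - + t) - + 2) + + 2 ℤ.* + suc a
      ≡⟨ cong₂ (λ p q → ((p - + t) - + 2) + + 2 ℤ.* q) (ℤP.pos-* 2 b) (ℤP.pos-+ 1 a) ⟩
    ((+ 2 ℤ.* + b - + t) - + 2) + + 2 ℤ.* (+ 1 + + a)
      ≡⟨ regroup (+ b) (+ a) (+ t) ⟩
    (+ 2 ℤ.* + a - + t) + + 2 ℤ.* + b
      ≡⟨ cong (λ p → (p - + t) + + 2 ℤ.* + b) (ℤP.pos-* 2 a) ⟨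
    (+ (2 ℕ.* a) - + t) + + 2 ℤ.* + b ∎
    where
    open ≡-Reasoning
    a = ∣ Y ∩ B ∣
    b = ∣ B ∣
    t = tval u v B
    regroup : ∀ b a t → ((+ 2 ℤ.* b - t) - + 2) + + 2 ℤ.* (+ 1 + a) ≡ (+ 2 ℤ.* a - t) + + 2 ℤ.* b
    regroup = solve-∀

  ∑famTerm+2*∑∣∩∣≡∑surplus+2*∑∣∣ : ∀ 𝓛 →
    ∑ (famTerm u v) 𝓛 + + 2 ℤ.* ∑ (λ B → + suc ∣ Y ∩ B ∣) 𝓛 ≡ ∑ surplus 𝓛 + + 2 ℤ.* ∑ (λ B → + ∣ B ∣) 𝓛
  ∑famTerm+2*∑∣∩∣≡∑surplus+2*∑∣∣ 𝓛 = begin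
    ∑ (famTerm u v) 𝓛 + + 2 ℤ.* ∑ (λ B → + suc ∣ Y ∩ B ∣) 𝓛
      ≡⟨ ∑-+-*ˡ (famTerm u v) (+ 2) (λ B → + suc ∣ Y ∩ B ∣) 𝓛 ⟨
    ∑ (λ B → famTerm u v B + + 2 ℤ.* + suc ∣ Y ∩ B ∣) 𝓛
      ≡⟨ ∑-cong famTerm+2*∣∩∣≡surplus+2*∣∣ 𝓛 ⟩
    ∑ (λ B → surplus B + + 2 ℤ.* + ∣ B ∣) 𝓛
      ≡⟨ ∑-+-*ˡ surplus (+ 2) (λ B → + ∣ B ∣) 𝓛 ⟩
    ∑ surplus 𝓛 + + 2 ℤ.* ∑ (λ B → + ∣ B ∣) 𝓛 ∎
    where open ≡-Reasoning

  iSet-∩≤valSet : ∀ (G : Graph n) B → UVSparse G u v → Absorbs Y B → Y ∩ B ≢ pair u v →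
                  + iSet G (Y ∩ B) ℤ.≤ valSet u v (Y ∩ B)
  iSet-∩≤valSet G B sparse (inj₁ 2≤∣Y∩B∣) _ = proj₁ sparse _ 2≤∣Y∩B∣
  iSet-∩≤valSet G B sparse absorbs@(inj₂ (∣Y∩B∣≡1 , _)) Y∩B≢uv =
    subst (λ i → + i ℤ.≤ valSet u v (Y ∩ B)) (sym (∣p∣≡1⇒iSet≡0 G ∣Y∩B∣≡1))
          (valSet-nonneg u v (Y ∩ B) (absorbs⇒1≤∣∩∣ Y absorbs) Y∩B≢uv)

  module _ (B : Subset n) (absorbs : Absorbs Y B) (3≤∣B∣ : 3 ≤ ∣ B ∣) (Y∩B≢uv : Y ∩ B ≢ pair u v) where

    tval≤tval-∩ : tval u v B ≤ tval u v (Y ∩ B)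
    tval≤tval-∩ = subst₂ _≤_ (sym (tval-≢pair u v B (3≤∣p∣⇒p≢pair u v 3≤∣B∣)))
                             (sym (tval-≢pair u v (Y ∩ B) Y∩B≢uv)) (by-size absorbs)
      where
      by-size : Absorbs Y B → tvalOfSize ∣ B ∣ ≤ tvalOfSize ∣ Y ∩ B ∣
      by-size (inj₁ 2≤∣Y∩B∣)     = tvalOfSize-antitone 2≤∣Y∩B∣ (SP.∣p∩q∣≤∣q∣ Y B)
      by-size (inj₂ (_ , 4≤∣B∣)) =
        subst (_≤ tvalOfSize ∣ Y ∩ B ∣) (sym (tvalOfSize-≥4 4≤∣B∣)) (2≤tvalOfSize ∣ Y ∩ B ∣)

    valSet-∩≤surplus : valSet u v (Y ∩ B) ℤ.≤ surplus B
    valSet-∩≤surplus = ℤP.+-monoʳ-≤ (+ (2 ℕ.* ∣ Y ∩ B ∣)) (ℤP.neg-mono-≤ (ℤ.+≤+ tval≤tval-∩))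

    0≤surplus : + 0 ℤ.≤ surplus B
    0≤surplus = ℤP.≤-trans (valSet-nonneg u v (Y ∩ B) (absorbs⇒1≤∣∩∣ Y absorbs) Y∩B≢uv) valSet-∩≤surplus

    iSet-∩≤surplus : ∀ (G : Graph n) → UVSparse G u v → + iSet G (Y ∩ B) ℤ.≤ surplus B
    iSet-∩≤surplus G sparse = ℤP.≤-trans (iSet-∩≤valSet G B sparse absorbs Y∩B≢uv) valSet-∩≤surplus

    iSet-∩≡surplus⇒tight : ∀ (G : Graph n) → UVSparse G u v →
                           + iSet G (Y ∩ B) ≡ surplus B → TightSet G u v (Y ∩ B)
    iSet-∩≡surplus⇒tight G sparse i≡surplus = ℤP.≤-antisym (iSet-∩≤valSet G B sparse absorbs Y∩B≢uv)
      (ℤP.≤-trans valSet-∩≤surplus (ℤP.≤-reflexive (sym i≡surplus)))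

module _ {n : ℕ} {u v : Fin n} {Y : Subset n} where

  u∈pair : u ∈ pair u v
  u∈pair = SP.p⊆p∪q ⁅ v ⁆ (SP.x∈⁅x⁆ u)

  v∈pair : v ∈ pair u v
  v∈pair = SP.q⊆p∪q ⁅ u ⁆ ⁅ v ⁆ (SP.x∈⁅x⁆ v)

  ¬pair⊆ : u ≢ v → ∣ Y ∩ pair u v ∣ ≤ 1 → u ∈ Y → v ∈ Y → ⊥
  ¬pair⊆ u≢v ∣Y∩uv∣≤1 u∈Y v∈Y = ℕP.<-irrefl refl (ℕP.≤-trans
    (x≢y⇒2≤∣p∣ u≢v (SP.x∈p∩q⁺ (u∈Y , u∈pair)) (SP.x∈p∩q⁺ (v∈Y , v∈pair))) ∣Y∩uv∣≤1)

  ∩≢pair : (u ∈ Y → v ∈ Y → ⊥) → ∀ B → Y ∩ B ≢ pair u v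
  ∩≢pair ¬uv∈Y B Y∩B≡uv = ¬uv∈Y (∈Y u∈pair) (∈Y v∈pair)
    where
    ∈Y : ∀ {x} → x ∈ pair u v → x ∈ Y
    ∈Y x∈uv = proj₁ (SP.x∈p∩q⁻ Y B (subst (_ ∈_) (sym Y∩B≡uv) x∈uv))

  outsider : (u ∈ Y → v ∈ Y → ⊥) → Σ (Fin n) λ w → w ∉ Y × (∀ {B} → u ∈ B → v ∈ B → w ∈ B)
  outsider ¬uv∈Y with u ∈? Y
  ... | no  u∉Y = u , u∉Y , λ u∈B _ → u∈B
  ... | yes u∈Y = v , ¬uv∈Y u∈Y , λ _ v∈B → v∈B

module Merge {n : ℕ} (u v : Fin n) (Y : Subset n) (w : Fin n) (𝓗 : List (Subset n)) where

  absorbed kept : List (Subset n)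
  absorbed = filter (absorbs? Y) 𝓗
  kept     = filter (¬? ∘ absorbs? Y) 𝓗

  -- Adding w, which lies in every member, lets each absorbed member meet the rest in ∣ Y ∩ B ∣ + 1 points.
  hub : Subset n
  hub = (⁅ w ⁆ ∪ Y) ∪⋃ absorbed

  merged : List (Subset n)
  merged = hub ∷ kept

  Y⊆hub : Y ⊆ hub
  Y⊆hub = p⊆p∪⋃ _ absorbed ∘ SP.q⊆p∪q ⁅ w ⁆ Y

  absorbed⊆hub : ∀ {B} → B ∈ₗ 𝓗 → Absorbs Y B → B ⊆ hub
  absorbed⊆hub B∈𝓗 absorbs = ∈⇒⊆∪⋃ _ (∈-filter⁺ (absorbs? Y) B∈𝓗 absorbs)

  ∣Y∣≤∣hub∣ : ∣ Y ∣ ≤ ∣ hub ∣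
  ∣Y∣≤∣hub∣ = SP.p⊆q⇒∣p∣≤∣q∣ Y⊆hub

  absorbed-members : UVCompatible u v 𝓗 → All (λ B → Absorbs Y B × 3 ≤ ∣ B ∣) absorbed
  absorbed-members (members , _) =
    All.zipWith (λ (absorbs , _ , _ , 3≤∣B∣) → absorbs , 3≤∣B∣)
                (AllP.all-filter (absorbs? Y) 𝓗 , AllP.filter⁺ (absorbs? Y) members)

  hub∉kept : 2 ≤ ∣ Y ∣ → All (hub ≢_) kept
  hub∉kept 2≤∣Y∣ = All.tabulate λ B∈kept hub≡B →
    let _ , ¬absorbs = ∈-filter⁻ (¬? ∘ absorbs? Y) {xs = 𝓗} B∈kept
        Y⊆Y∩B : Y ⊆ Y ∩ _
        Y⊆Y∩B y∈Y = SP.x∈p∩q⁺ (y∈Y , subst (_ ∈_) hub≡B (Y⊆hub y∈Y))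
    in ¬absorbs (inj₁ (ℕP.≤-trans 2≤∣Y∣ (SP.p⊆q⇒∣p∣≤∣q∣ Y⊆Y∩B)))

  merged-compatible : 4 ≤ ∣ Y ∣ → UVCompatible u v 𝓗 → ∀ {H} → H ∈ₗ 𝓗 → Absorbs Y H → UVCompatible u v merged
  merged-compatible 4≤∣Y∣ (members , unique) H∈𝓗 absorbs =
    ((H⊆hub u∈H , H⊆hub v∈H , 3≤∣hub∣) ∷ AllP.filter⁺ (¬? ∘ absorbs? Y) members) ,
    (hub∉kept (ℕP.≤-trans (s≤s (s≤s z≤n)) 4≤∣Y∣) ∷ UniqueP.filter⁺ (¬? ∘ absorbs? Y) unique)
    where
    H⊆hub = absorbed⊆hub H∈𝓗 absorbs
    u∈H = proj₁ (All.lookup members H∈𝓗)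
    v∈H = proj₁ (proj₂ (All.lookup members H∈𝓗))
    3≤∣hub∣ = ℕP.≤-trans (ℕP.n≤1+n 3) (ℕP.≤-trans 4≤∣Y∣ ∣Y∣≤∣hub∣)

  merged-covers : ∀ x y → Cov 𝓗 x y ⊎ (x ∈ Y × y ∈ Y) → Cov merged x y
  merged-covers x y (inj₂ (x∈Y , y∈Y)) = here (Y⊆hub x∈Y , Y⊆hub y∈Y)
  merged-covers x y (inj₁ x,y∈𝓗) with find x,y∈𝓗
  ... | S , S∈𝓗 , x∈S , y∈S with absorbs? Y S
  ...   | yes absorbs = here (absorbed⊆hub S∈𝓗 absorbs x∈S , absorbed⊆hub S∈𝓗 absorbs y∈S)
  ...   | no ¬absorbs = there (lose (∈-filter⁺ (¬? ∘ absorbs? Y) S∈𝓗 ¬absorbs) (x∈S , y∈S))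

  iFam+iSet≤iFam-merged+∑iSet : ∀ (G : Graph n) →
    iFam G 𝓗 ℕ.+ iSet G Y ≤ iFam G merged ℕ.+ sum (map (λ B → iSet G (Y ∩ B)) absorbed)
  iFam+iSet≤iFam-merged+∑iSet G = begin
    iFam G 𝓗 ℕ.+ iSet G Y
      ≡⟨ countEdges-∨-∧ G (inFam 𝓗) inY ⟨
    countEdges G (λ x y → inFam 𝓗 x y ∨ inY x y) ℕ.+ countEdges G (λ x y → inFam 𝓗 x y ∧ inY x y)
      ≤⟨ ℕP.+-mono-≤ (countEdges-mono G covered) (countEdges-mono G shared) ⟩
    iFam G merged ℕ.+ iFam G Y∩absorbed
      ≤⟨ ℕP.+-monoʳ-≤ (iFam G merged) (iFam≤sum-iSet G Y∩absorbed) ⟩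
    iFam G merged ℕ.+ sum (map (iSet G) Y∩absorbed)
      ≡⟨ cong (λ p → iFam G merged ℕ.+ sum p) (map-∘ absorbed) ⟨
    iFam G merged ℕ.+ sum (map (λ B → iSet G (Y ∩ B)) absorbed) ∎
    where
    open ℕP.≤-Reasoning
    inFam : List (Subset n) → Fin n → Fin n → Bool
    inFam 𝓛 x y = does (any? (λ S → (x ∈? S) ×-dec (y ∈? S)) 𝓛)
    inY : Fin n → Fin n → Bool
    inY x y = does (x ∈? Y) ∧ does (y ∈? Y)
    Y∩absorbed = map (Y ∩_) absorbed
    ∈Y : ∀ x y → T (inY x y) → x ∈ Y × y ∈ Y
    ∈Y x y t = let tx , ty = Equivalence.to T-∧ t in does⇒ (x ∈? Y) tx , does⇒ (y ∈? Y) ty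
    covered : ∀ x y → x F.< y → T (adj G x y) → T (inFam 𝓗 x y ∨ inY x y) → T (inFam merged x y)
    covered x y _ _ t = ⇒does (any? _ merged) (merged-covers x y (decode (Equivalence.to T-∨ t)))
      where
      decode : T (inFam 𝓗 x y) ⊎ T (inY x y) → Cov 𝓗 x y ⊎ (x ∈ Y × y ∈ Y)
      decode (inj₁ t𝓗) = inj₁ (does⇒ (any? _ 𝓗) t𝓗)
      decode (inj₂ tY) = inj₂ (∈Y x y tY)
    shared : ∀ x y → x F.< y → T (adj G x y) → T (inFam 𝓗 x y ∧ inY x y) → T (inFam Y∩absorbed x y)
    shared x y x<y _ t =
      let t𝓗 , tY = Equivalence.to T-∧ t
          S , S∈𝓗 , x∈S , y∈S = find (does⇒ (any? _ 𝓗) t𝓗)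
          x∈Y , y∈Y = ∈Y x y tY
          x∈Y∩S = SP.x∈p∩q⁺ (x∈Y , x∈S)
          y∈Y∩S = SP.x∈p∩q⁺ (y∈Y , y∈S)
          S∈absorbed = ∈-filter⁺ (absorbs? Y) S∈𝓗 (inj₁ (x≢y⇒2≤∣p∣ (FP.<⇒≢ x<y) x∈Y∩S y∈Y∩S))
      in ⇒does (any? _ Y∩absorbed) (lose (∈-map⁺ (Y ∩_) S∈absorbed) (x∈Y∩S , y∈Y∩S))

  ∣hub∣-bound : w ∉ Y → All (w ∈_) 𝓗 →
                ∣ hub ∣ ℕ.+ sum (map (λ B → suc ∣ Y ∩ B ∣) absorbed) ≤ suc ∣ Y ∣ ℕ.+ sum (map ∣_∣ absorbed)
  ∣hub∣-bound w∉Y w∈𝓗 = begin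
    ∣ hub ∣ ℕ.+ sum (map (λ B → suc ∣ Y ∩ B ∣) absorbed)
      ≤⟨ ℕP.+-monoʳ-≤ ∣ hub ∣ (sum-map-mono (All.map grows (AllP.filter⁺ (absorbs? Y) w∈𝓗))) ⟩
    ∣ hub ∣ ℕ.+ sum (map (λ B → ∣ B ∩ Z ∣) absorbed)  ≤⟨ ∣∪⋃∣-bound Z absorbed ⟩
    ∣ Z ∣ ℕ.+ sum (map ∣_∣ absorbed)                  ≤⟨ ℕP.+-monoˡ-≤ _ ∣Z∣≤1+∣Y∣ ⟩
    suc ∣ Y ∣ ℕ.+ sum (map ∣_∣ absorbed)              ∎
    where
    open ℕP.≤-Reasoning
    Z = ⁅ w ⁆ ∪ Y
    ∣Z∣≤1+∣Y∣ : ∣ Z ∣ ≤ suc ∣ Y ∣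
    ∣Z∣≤1+∣Y∣ = subst (λ k → ∣ Z ∣ ≤ k ℕ.+ ∣ Y ∣) (SP.∣⁅x⁆∣≡1 w) (∣p∪q∣≤∣p∣+∣q∣ ⁅ w ⁆ Y)
    grows : ∀ {B} → w ∈ B → suc ∣ Y ∩ B ∣ ≤ ∣ B ∩ Z ∣
    grows {B} w∈B = SP.p⊂q⇒∣p∣<∣q∣
      ( (λ x∈Y∩B → let x∈Y , x∈B = SP.x∈p∩q⁻ Y B x∈Y∩B in SP.x∈p∩q⁺ (x∈B , SP.q⊆p∪q ⁅ w ⁆ Y x∈Y))
      , w , SP.x∈p∩q⁺ (w∈B , SP.p⊆p∪q Y (SP.x∈⁅x⁆ w)) , λ w∈Y∩B → w∉Y (proj₁ (SP.x∈p∩q⁻ Y B w∈Y∩B)) )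

  module _ (4≤∣Y∣ : 4 ≤ ∣ Y ∣) (w∉Y : w ∉ Y) (w∈𝓗 : All (w ∈_) 𝓗) where

    famTerm-hub+∑surplus≤∑famTerm+valSet :
      famTerm u v hub + ∑ (surplus u v Y) absorbed ℤ.≤ ∑ (famTerm u v) absorbed + valSet u v Y
    famTerm-hub+∑surplus≤∑famTerm+valSet = begin
      famTerm u v hub + E
        ≡⟨ cong (λ p → p - + 2 + E) (valSet-≥4 u v hub 4≤∣hub∣) ⟩
      ((+ 2 ℤ.* h - + 2) - + 2) + E
        ≡⟨ regroup₁ h α E ⟩
      + 2 ℤ.* (h + α) + (E - + 4 - + 2 ℤ.* α)
        ≤⟨ ℤP.+-monoˡ-≤ _ (ℤP.*-monoˡ-≤-nonNeg (+ 2) ∣hub∣-bound-ℤ) ⟩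
      + 2 ℤ.* ((+ 1 + y) + σ) + (E - + 4 - + 2 ℤ.* α)
        ≡⟨ regroup₂ y σ E α ⟩
      (+ 2 ℤ.* y - + 2) + (E + + 2 ℤ.* σ) - + 2 ℤ.* α
        ≡⟨ cong (λ p → (+ 2 ℤ.* y - + 2) + p - + 2 ℤ.* α) (∑famTerm+2*∑∣∩∣≡∑surplus+2*∑∣∣ u v Y absorbed) ⟨
      (+ 2 ℤ.* y - + 2) + (N + + 2 ℤ.* α) - + 2 ℤ.* α
        ≡⟨ regroup₃ y N α ⟩
      N + (+ 2 ℤ.* y - + 2)
        ≡⟨ cong (_+_ N) (valSet-≥4 u v Y 4≤∣Y∣) ⟨
      N + valSet u v Y ∎
      where
      open ℤP.≤-Reasoning
      h y α σ E N : ℤ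
      h = + ∣ hub ∣
      y = + ∣ Y ∣
      α = ∑ (λ B → + suc ∣ Y ∩ B ∣) absorbed
      σ = ∑ (λ B → + ∣ B ∣) absorbed
      E = ∑ (surplus u v Y) absorbed
      N = ∑ (famTerm u v) absorbed
      4≤∣hub∣ = ℕP.≤-trans 4≤∣Y∣ ∣Y∣≤∣hub∣
      ∣hub∣-bound-ℤ : h + α ℤ.≤ (+ 1 + y) + σ
      ∣hub∣-bound-ℤ = subst₂ ℤ._≤_
        (trans (ℤP.pos-+ ∣ hub ∣ _) (cong (_+_ h) (sym (∑-pos (λ B → suc ∣ Y ∩ B ∣) absorbed))))
        (trans (ℤP.pos-+ (suc ∣ Y ∣) _) (cong₂ _+_ (ℤP.pos-+ 1 ∣ Y ∣) (sym (∑-pos ∣_∣ absorbed))))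
        (ℤ.+≤+ (∣hub∣-bound w∉Y w∈𝓗))
      regroup₁ : ∀ h α E → ((+ 2 ℤ.* h - + 2) - + 2) + E ≡ + 2 ℤ.* (h + α) + (E - + 4 - + 2 ℤ.* α)
      regroup₁ = solve-∀
      regroup₂ : ∀ y σ E α → + 2 ℤ.* ((+ 1 + y) + σ) + (E - + 4 - + 2 ℤ.* α)
                             ≡ (+ 2 ℤ.* y - + 2) + (E + + 2 ℤ.* σ) - + 2 ℤ.* α
      regroup₂ = solve-∀
      regroup₃ : ∀ y N α → (+ 2 ℤ.* y - + 2) + (N + + 2 ℤ.* α) - + 2 ℤ.* α ≡ N + (+ 2 ℤ.* y - + 2)
      regroup₃ = solve-∀

    valFam-merged+∑surplus≤ : valFam u v merged + ∑ (surplus u v Y) absorbed ℤ.≤ valFam u v 𝓗 + valSet u v Y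
    valFam-merged+∑surplus≤ = begin
      valFam u v merged + E
        ≡⟨ cong (λ p → p + E) (valFam-∑ u v merged) ⟩
      (+ 2 + (famTerm u v hub + Nₖ)) + E
        ≡⟨ regroup₁ (+ 2) (famTerm u v hub) Nₖ E ⟩
      (+ 2 + Nₖ) + (famTerm u v hub + E)
        ≤⟨ ℤP.+-monoʳ-≤ (+ 2 + Nₖ) famTerm-hub+∑surplus≤∑famTerm+valSet ⟩
      (+ 2 + Nₖ) + (Nₐ + valSet u v Y)
        ≡⟨ regroup₂ (+ 2) Nₖ Nₐ (valSet u v Y) ⟩
      (+ 2 + (Nₐ + Nₖ)) + valSet u v Y
        ≡⟨ cong (λ p → (+ 2 + p) + valSet u v Y) (∑-partition (absorbs? Y) (famTerm u v) 𝓗) ⟨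
      (+ 2 + ∑ (famTerm u v) 𝓗) + valSet u v Y
        ≡⟨ cong (λ p → p + valSet u v Y) (valFam-∑ u v 𝓗) ⟨
      valFam u v 𝓗 + valSet u v Y ∎
      where
      open ℤP.≤-Reasoning
      E = ∑ (surplus u v Y) absorbed
      Nₐ = ∑ (famTerm u v) absorbed
      Nₖ = ∑ (famTerm u v) kept
      regroup₁ : ∀ a b c d → (a + (b + c)) + d ≡ (a + c) + (b + d)
      regroup₁ = solve-∀
      regroup₂ : ∀ a c b y → (a + c) + (b + y) ≡ (a + (b + c)) + y
      regroup₂ = solve-∀

    module _ (¬uv⊆Y : u ∈ Y → v ∈ Y → ⊥) (compatible : UVCompatible u v 𝓗) where

      valFam-merged≤ : valFam u v merged ℤ.≤ valFam u v 𝓗 + valSet u v Y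
      valFam-merged≤ = ℤP.≤-trans (ℤP.i≤i+j _ E {{ℤ.nonNegative 0≤E}}) valFam-merged+∑surplus≤
        where
        E = ∑ (surplus u v Y) absorbed
        0≤E : + 0 ℤ.≤ E
        0≤E = ∑-nonneg (All.map (λ {B} (absorbs , 3≤∣B∣) → 0≤surplus u v Y B absorbs 3≤∣B∣ (∩≢pair ¬uv⊆Y B))
                                (absorbed-members compatible))

      merged-tight : ∀ (G : Graph n) → UVSparse G u v → TightFam G u v 𝓗 → TightSet G u v Y →
                     ∀ {H} → H ∈ₗ 𝓗 → Absorbs Y H → TightFam G u v merged × TightSet G u v (Y ∩ H)
      merged-tight G sparse tight-𝓗 tight-Y {H} H∈𝓗 absorbs =
        let tight-merged , ∑i≡∑surplus = +-squeeze i≤val-merged (∑-mono-≤ i≤surplus) cycle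
            i≡surplus = ∑-squeeze i≤surplus (ℤP.≤-reflexive (sym ∑i≡∑surplus)) (∈-filter⁺ (absorbs? Y) H∈𝓗 absorbs)
        in tight-merged , iSet-∩≡surplus⇒tight u v Y H absorbs 3≤∣H∣ (∩≢pair ¬uv⊆Y H) G sparse i≡surplus
        where
        3≤∣H∣ = proj₂ (proj₂ (All.lookup (proj₁ compatible) H∈𝓗))
        i≤val-merged = proj₂ sparse merged (merged-compatible 4≤∣Y∣ compatible H∈𝓗 absorbs)
        i≤surplus : All (λ B → + iSet G (Y ∩ B) ℤ.≤ surplus u v Y B) absorbed
        i≤surplus = All.map (λ {B} (absorbs , 3≤∣B∣) →
                               iSet-∩≤surplus u v Y B absorbs 3≤∣B∣ (∩≢pair ¬uv⊆Y B) G sparse)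
                            (absorbed-members compatible)
        cycle : valFam u v merged + ∑ (surplus u v Y) absorbed
                ℤ.≤ + iFam G merged + ∑ (λ B → + iSet G (Y ∩ B)) absorbed
        cycle = begin
          valFam u v merged + ∑ (surplus u v Y) absorbed   ≤⟨ valFam-merged+∑surplus≤ ⟩
          valFam u v 𝓗 + valSet u v Y                      ≡⟨ cong₂ _+_ tight-𝓗 tight-Y ⟨
          + iFam G 𝓗 + + iSet G Y                          ≡⟨ ℤP.pos-+ (iFam G 𝓗) (iSet G Y) ⟨
          + (iFam G 𝓗 ℕ.+ iSet G Y)                        ≤⟨ ℤ.+≤+ (iFam+iSet≤iFam-merged+∑iSet G) ⟩
          + (iFam G merged ℕ.+ sum (map (λ B → iSet G (Y ∩ B)) absorbed))
            ≡⟨ trans (ℤP.pos-+ (iFam G merged) _)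
                     (cong (_+_ (+ iFam G merged)) (sym (∑-pos (λ B → iSet G (Y ∩ B)) absorbed))) ⟩
          + iFam G merged + ∑ (λ B → + iSet G (Y ∩ B)) absorbed ∎
          where open ℤP.≤-Reasoning

lemma3p5 : ∀ {n} (G : Graph n) (u v : Fin n) → u ≢ v →
    (𝓗 : List (Subset n)) → UVCompatible u v 𝓗 →
    (∀ (j l : Fin (length 𝓗)) → j ≢ l → lookup 𝓗 j ∩ lookup 𝓗 l ≡ pair u v) →
    (Y : Subset n) → 4 ≤ ∣ Y ∣ → ∣ Y ∩ pair u v ∣ ≤ 1 →
    (i : Fin (length 𝓗)) →
    (2 ≤ ∣ Y ∩ lookup 𝓗 i ∣ ⊎ (∣ Y ∩ lookup 𝓗 i ∣ ≡ 1 × 4 ≤ ∣ lookup 𝓗 i ∣)) →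
    Σ (List (Subset n)) λ 𝓗′ →
    UVCompatible u v 𝓗′ ×
    (∀ x y → (Cov 𝓗 x y ⊎ (x ∈ Y × y ∈ Y)) → Cov 𝓗′ x y) ×
    valFam u v 𝓗′ ℤ.≤ valFam u v 𝓗 + valSet u v Y ×
    (UVSparse G u v → TightFam G u v 𝓗 → TightSet G u v Y →
    TightFam G u v 𝓗′ × TightSet G u v (Y ∩ lookup 𝓗 i))
lemma3p5 G u v u≢v 𝓗 compatible _ Y 4≤∣Y∣ ∣Y∩uv∣≤1 i absorbs-Hᵢ =
  let w , w∉Y , w∈uv-sets = outsider ¬uv⊆Y
      w∈𝓗 = All.map (λ (u∈B , v∈B , _) → w∈uv-sets u∈B v∈B) (proj₁ compatible)
      open Merge u v Y w 𝓗
  in merged ,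
     merged-compatible 4≤∣Y∣ compatible Hᵢ∈𝓗 absorbs-Hᵢ ,
     merged-covers ,
     valFam-merged≤ 4≤∣Y∣ w∉Y w∈𝓗 ¬uv⊆Y compatible ,
     λ sparse tight-𝓗 tight-Y →
       merged-tight 4≤∣Y∣ w∉Y w∈𝓗 ¬uv⊆Y compatible G sparse tight-𝓗 tight-Y Hᵢ∈𝓗 absorbs-Hᵢ
  where
  ¬uv⊆Y = ¬pair⊆ u≢v ∣Y∩uv∣≤1
  Hᵢ∈𝓗 = ∈-lookup i
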